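{- Let $n\geq 5$ and let $\overrightarrow{G}$ be a nontrivial weakly connected spanning closed subgraph of $\overrightarrow{C_n^2}$. Then there exist integers $j,k$ with $0\leq j\leq n-1$ and $0\leq k\leq\lceil\frac{n-2}{2}\rceil$ such that $\overrightarrow{G}=\overrightarrow{S_{n,k,j}}$.
   Context: For $n\geq 5$, the directed square cycle $\overrightarrow{C_n^2}$ has vertex set $\mathbb{Z}_n$, writing $v_i=i+n\mathbb{Z}$ for $i\in\mathbb{Z}$ (indices modulo $n$), and edges $e_i=(v_i,v_{i+1})$ (frames) and $f_i=(v_i,v_{i+2})$ (windows), $i\in\mathbb{Z}$. A spanning subgraph has vertex set $\mathbb{Z}_n$ and a subset of the edges; it is weakly connected if its underlying undirected graph is connected. The triangle $T_i$ is $\{e_i,e_{i+1},f_i\}$; a subgraph $\overrightarrow{G}$ is closed if for every $i$, $|T_i\cap E(\overrightarrow{G})|\leq 1$ or $T_i\subseteq E(\overrightarrow{G})$. The trivial weakly connected spanning closed subgraphs are $\overrightarrow{C_n^2}$ itself and, when $n$ is odd, the subgraph whose edges are all the windows $f_0,\dots,f_{n-1}$; all others are nontrivial. For integers $j,k$ with $0\leq k\leq\lceil\frac{n-2}{2}\rceil$, $\overrightarrow{S_{n,k,j}}$ is the spanning subgraph of $\overrightarrow{C_n^2}$ with edge set $E(\overrightarrow{C_n^2})\setminus\big(\{f_{j-2},f_{j+2k-1}\}\cup\{e_{j-1},e_j,\dots,e_{j+2k-1}\}\big)$. -}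

module Defs where

open import Data.Nat using (ℕ; zero; suc; _≤_; _<_; NonZero; _/_; _∸_; _%_)
open import Data.Integer as ℤ using (ℤ; +_; _%ℕ_)
open import Data.Integer.DivMod using (n%ℕd<d)
open import Data.Fin using (Fin; fromℕ<; _≟_)
open import Data.Bool using (Bool; true; false; T; not; _∧_; if_then_else_)
open import Data.List using (List; upTo; map)
open import Data.Bool.ListAction using (any)
open import Data.Product using (_×_; _,_)
open import Data.Sum using (_⊎_)
open import Relation.Binary.PropositionalEquality using (_≡_)
open import Relation.Nullary using (¬_)
open import Relation.Nullary.Decidable using (⌊_⌋)

v : (n : ℕ) .{{_ : NonZero n}} → ℤ → Fin n
v n i = fromℕ< (n%ℕd<d i n)

-- A spanning subgraph of the directed square cycle: for each residue i,
-- whether the frame e_i = (v_i, v_{i+1}) and the window f_i = (v_i, v_{i+2})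
-- are present.
record Subgraph (n : ℕ) : Set where
  constructor mkSub
  field
    frame  : Fin n → Bool
    window : Fin n → Bool
open Subgraph public

hasE : {n : ℕ} .{{_ : NonZero n}} → Subgraph n → ℤ → Bool
hasE {n} G i = frame G (v n i)

hasF : {n : ℕ} .{{_ : NonZero n}} → Subgraph n → ℤ → Bool
hasF {n} G i = window G (v n i)

_≐_ : {n : ℕ} → Subgraph n → Subgraph n → Set
G ≐ H = (∀ i → frame G i ≡ frame H i) × (∀ i → window G i ≡ window H i)

data Adj {n : ℕ} .{{_ : NonZero n}} (G : Subgraph n) : Fin n → Fin n → Set where
  fwdE : (i : ℤ) → T (hasE G i) → Adj G (v n i) (v n (i ℤ.+ ℤ.+ 1))
  bwdE : (i : ℤ) → T (hasE G i) → Adj G (v n (i ℤ.+ ℤ.+ 1)) (v n i)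
  fwdF : (i : ℤ) → T (hasF G i) → Adj G (v n i) (v n (i ℤ.+ ℤ.+ 2))
  bwdF : (i : ℤ) → T (hasF G i) → Adj G (v n (i ℤ.+ ℤ.+ 2)) (v n i)

data Reach {n : ℕ} .{{_ : NonZero n}} (G : Subgraph n) : Fin n → Fin n → Set where
  here : ∀ {u} → Reach G u u
  step : ∀ {u w x} → Adj G u w → Reach G w x → Reach G u x

WeaklyConnected : {n : ℕ} .{{_ : NonZero n}} → Subgraph n → Set
WeaklyConnected G = ∀ u w → Reach G u w

b2n : Bool → ℕ
b2n true = 1
b2n false = 0

triCount : {n : ℕ} .{{_ : NonZero n}} → Subgraph n → ℤ → ℕ
triCount G i = b2n (hasE G i) Data.Nat.+ b2n (hasE G (i ℤ.+ ℤ.+ 1)) Data.Nat.+ b2n (hasF G i)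

Closed : {n : ℕ} .{{_ : NonZero n}} → Subgraph n → Set
Closed G = ∀ (i : ℤ) → triCount G i ≤ 1 ⊎ triCount G i ≡ 3

Full : (n : ℕ) → Subgraph n
Full n = mkSub (λ _ → true) (λ _ → true)

WindowsOnly : (n : ℕ) → Subgraph n
WindowsOnly n = mkSub (λ _ → false) (λ _ → true)

Odd : ℕ → Set
Odd n = n % 2 ≡ 1

Nontrivial : {n : ℕ} → Subgraph n → Set
Nontrivial {n} G = ¬ (G ≐ Full n) × ¬ (Odd n × G ≐ WindowsOnly n)

-- ⌈(n-2)/2⌉ = ⌊(n-1)/2⌋ for n ≥ 2
ceilHalfNm2 : ℕ → ℕ
ceilHalfNm2 n = (n ∸ 1) / 2

S : (n : ℕ) .{{_ : NonZero n}} → ℕ → ℤ → Subgraph n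
S n k j = mkSub fr wi
  where
    removedFrames : List (Fin n)
    removedFrames = map (λ t → v n (j ℤ.- ℤ.+ 1 ℤ.+ ℤ.+ t)) (upTo (suc (2 Data.Nat.* k)))
    fr : Fin n → Bool
    fr i = not (any (λ x → ⌊ x ≟ i ⌋) removedFrames)
    wi : Fin n → Bool
    wi i = not (⌊ v n (j ℤ.- ℤ.+ 2) ≟ i ⌋ Data.Bool.∨ ⌊ v n (j ℤ.+ ℤ.+ (2 Data.Nat.* k) ℤ.- ℤ.+ 1) ≟ i ⌋)

module Submission where

-- Write e x and f x for the presence of the frame e_x and the window f_x, x ∈ ℕ read modulo n.
-- Closedness forces f_x when e_x and e_{x+1} are both present and forbids it when exactly one is.
-- Weak connectivity is used only through cuts: a set of vertices that no present edge leaves is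
-- empty or everything.  Call a maximal block of absent frames e_{p+1}, …, e_{p+L} a gap.  Its
-- boundary windows f_p and f_{p+L} are absent, so for even L the vertices p+2, p+4, …, p+L would
-- be cut off; every gap is odd, and the same argument on sub-blocks shows that all windows strictly
-- inside it are present.  Two gaps cannot coexist: the even vertices of the first, the frame path
-- to the second and every other vertex of the second would form a cut.  Hence either all frames are
-- present (G is the whole graph), or none is (for even n the windows preserve parity; for odd n
-- they form one cycle, of which at most one window can be missing), or there is exactly one gap,
-- of length 2k + 1, and G is S_{n,k,p+2}.

open import Defs
open import Data.Bool using (Bool; true; false; T; not; _∨_)
open import Data.Bool.Properties using (T-≡; ¬-not; ∨-zeroʳ) renaming (_≟_ to _≟ᵇ_)
open import Data.Empty using (⊥; ⊥-elim)
open import Data.Bool.ListAction using (any)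
open import Data.Fin using (Fin; toℕ; _≟_)
open import Data.Fin.Properties using (toℕ-fromℕ<; toℕ-injective; toℕ<n)
open import Data.Integer as ℤ using (+_; -[1+_]; _%ℕ_)
open import Data.Integer.DivMod using (n%ℕd<d)
import Data.Integer.Properties as ℤ
open import Data.Nat hiding (_≟_)
import Data.Nat as ℕ
open import Data.Nat.DivMod
open import Data.Nat.Properties hiding (_≟_)
open import Data.Nat.Tactic.RingSolver using (solve-∀)
open import Data.List using (map; upTo)
open import Data.List.Membership.Propositional using (find; lose)
open import Data.List.Membership.Propositional.Properties using (∈-upTo⁺; ∈-upTo⁻)
open import Data.List.Relation.Unary.Any.Properties using (map⁺; map⁻; any⁺; any⁻)
open import Data.Product using (Σ; ∃-syntax; _×_; _,_; proj₁; proj₂)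
open import Data.Sum using (_⊎_; inj₁; inj₂; [_,_]′)
open import Function.Base using (_∘_)
open import Function.Bundles using (_⇔_; mk⇔; Equivalence)
open import Function.Properties.Equivalence using (⇔-isEquivalence)
open import Relation.Binary.Structures using (IsEquivalence)
open import Relation.Binary.PropositionalEquality
open import Relation.Binary.Definitions using (tri<; tri≈; tri>)
open import Relation.Nullary using (¬_; contradiction; yes; no; Dec)
open import Relation.Nullary.Decidable using (⌊_⌋; isYes≗does; dec-true; dec-false; toWitness; fromWitness)

module ⇔ {ℓ} = IsEquivalence (⇔-isEquivalence {ℓ})
open Equivalence using (to; from)

clash : ∀ {b : Bool} → b ≡ true → b ≡ false → ⊥
clash refl ()

clash-at : ∀ (g : ℕ → Bool) {x y} → g x ≡ true → x ≡ y → g y ≡ false → ⊥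
clash-at g h refl h′ = clash h h′

none-below : ∀ {g : ℕ → Bool} {b n} → ¬ (∃[ x ] x < n × g x ≡ b) → ∀ x → x < n → g x ≡ not b
none-below ∄ x x<n = ¬-not (λ eq → ∄ (x , x<n , eq))

⌊⌋-yes : ∀ {A : Set} (a? : Dec A) → A → ⌊ a? ⌋ ≡ true
⌊⌋-yes a? a = trans (isYes≗does a?) (dec-true a? a)

⌊⌋-no : ∀ {A : Set} (a? : Dec A) → ¬ A → ⌊ a? ⌋ ≡ false
⌊⌋-no a? ¬a = trans (isYes≗does a?) (dec-false a? ¬a)

any-≟-upTo : ∀ {n} (g : ℕ → Fin n) L x →
  T (any (λ y → ⌊ y ≟ x ⌋) (map g (upTo L))) ⇔ (∃[ t ] t < L × g t ≡ x)
any-≟-upTo g L x = mk⇔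
  (λ h → let t , t∈ , gt≡x = find (map⁻ (any⁻ _ _ h)) in t , ∈-upTo⁻ t∈ , toWitness gt≡x)
  (λ (t , t<L , gt≡x) → any⁺ _ (map⁺ (lose (∈-upTo⁺ t<L) (fromWitness gt≡x))))

least-true : ∀ (g : ℕ → Bool) n → g n ≡ true →
  ∃[ L ] L ≤ n × g L ≡ true × (∀ t → t < L → g t ≡ false)
least-true g zero gn = 0 , z≤n , gn , λ _ ()
least-true g (suc n) gn with g 0 in g0
... | true  = 0 , z≤n , g0 , λ _ ()
... | false with least-true (g ∘ suc) n gn
...   | L , L≤n , gL , below = suc L , s≤s L≤n , gL , below′
  where
  below′ : ∀ t → t < suc L → g t ≡ false
  below′ zero    _         = g0
  below′ (suc t) (s≤s t<L) = below t t<L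

transition : ∀ (g : ℕ → Bool) n → g 0 ≡ true → g n ≡ false →
  ∃[ u ] u < n × g u ≡ true × g (suc u) ≡ false
transition g zero    g0 gn = ⊥-elim (clash g0 gn)
transition g (suc n) g0 gn with g n in eq
... | true  = n , ≤-refl , eq , gn
... | false with transition g n g0 eq
...   | u , u<n , gu , gsu = u , m<n⇒m<1+n u<n , gu , gsu

even-or-odd : ∀ n → (∃[ h ] n ≡ 2 * h) ⊎ (∃[ h ] n ≡ suc (2 * h))
even-or-odd zero = inj₁ (0 , refl)
even-or-odd (suc n) with even-or-odd n
... | inj₁ (h , refl) = inj₂ (h , refl)
... | inj₂ (h , refl) = inj₁ (suc h , cong suc (sym (+-suc h (h + 0))))

odd-complement : ∀ {h k} → h < k → ∃[ r ] suc (2 * h) + (2 + 2 * r) ≡ suc (2 * k)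
odd-complement {h} h<k with m≤n⇒∃[o]m+o≡n h<k
... | r , refl = r , identity h r
  where
  identity : ∀ h r → suc (2 * h) + (2 + 2 * r) ≡ suc (2 * (suc h + r))
  identity = solve-∀

2*≤⇒≤/2 : ∀ {k a} → 2 * k ≤ a → k ≤ a / 2
2*≤⇒≤/2 {k} {a} le = subst (_≤ a / 2) (trans (/-congˡ (*-comm 2 k)) (m*n/n≡m k 2)) (/-monoˡ-≤ 2 le)

Run : ℕ → ℕ → ℕ → Set
Run a j d = ∃[ i ] i ≤ j × d ≡ a + 2 * i

+-2*-suc : ∀ a i → a + 2 * suc i ≡ 2 + (a + 2 * i)
+-2*-suc = solve-∀

run-bounds : ∀ a {j d} → Run a j d → a ≤ d × d ≤ a + 2 * j
run-bounds a (i , i≤j , refl) = m≤m+n a _ , +-monoʳ-≤ a (*-monoʳ-≤ 2 i≤j)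

run-next : ∀ a {j d} → Run a j d → d ≡ a + 2 * j ⊎ Run a j (2 + d)
run-next a (i , i≤j , refl) with m≤n⇒m<n∨m≡n i≤j
... | inj₁ i<j  = inj₂ (suc i , i<j , sym (+-2*-suc a i))
... | inj₂ refl = inj₁ refl

run-prev : ∀ a {j d} → Run a j (2 + d) → 2 + d ≡ a ⊎ Run a j d
run-prev a (zero , _ , eq) = inj₁ (trans eq (+-identityʳ a))
run-prev a {d = d} (suc i , i<j , eq) =
  inj₂ (i , <⇒≤ i<j , +-cancelˡ-≡ 2 d _ (trans eq (+-2*-suc a i)))

module Residues (N : ℕ) .{{_ : NonZero N}} where
  open ≡-Reasoning

  %-absorbˡ : ∀ a b → (a % N + b) % N ≡ (a + b) % N
  %-absorbˡ a b = begin
    (a % N + b) % N           ≡⟨ %-distribˡ-+ (a % N) b N ⟩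
    (a % N % N + b % N) % N   ≡⟨ cong (λ z → (z + b % N) % N) (m%n%n≡m%n a N) ⟩
    (a % N + b % N) % N       ≡⟨ %-distribˡ-+ a b N ⟨
    (a + b) % N               ∎

  %-absorbʳ : ∀ a b → (a + b % N) % N ≡ (a + b) % N
  %-absorbʳ a b = begin
    (a + b % N) % N ≡⟨ %-congˡ (+-comm a (b % N)) ⟩
    (b % N + a) % N ≡⟨ %-absorbˡ b a ⟩
    (b + a) % N     ≡⟨ %-congˡ (+-comm b a) ⟩
    (a + b) % N     ∎

  -- Adding a * (N - 1) turns a + b into b modulo N.
  %-cancelˡ-+ : ∀ a b c → (a + b) % N ≡ (a + c) % N → b % N ≡ c % N
  %-cancelˡ-+ a b c eq = begin
    b % N                            ≡⟨ [m+kn]%n≡m%n b a N ⟨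
    (b + a * N) % N                  ≡⟨ %-congˡ (shift b) ⟩
    ((a + b) + a * pred N) % N       ≡⟨ %-absorbˡ (a + b) _ ⟨
    ((a + b) % N + a * pred N) % N   ≡⟨ cong (λ z → (z + a * pred N) % N) eq ⟩
    ((a + c) % N + a * pred N) % N   ≡⟨ %-absorbˡ (a + c) _ ⟩
    ((a + c) + a * pred N) % N       ≡⟨ %-congˡ (shift c) ⟨
    (c + a * N) % N                  ≡⟨ [m+kn]%n≡m%n c a N ⟩
    c % N                            ∎
    where
    shift : ∀ x → x + a * N ≡ (a + x) + a * pred N
    shift x = begin
      x + a * N               ≡⟨ cong (λ z → x + a * z) (suc-pred N) ⟨
      x + a * suc (pred N)    ≡⟨ cong (λ z → x + z) (*-suc a (pred N)) ⟩
      x + (a + a * pred N)    ≡⟨ +-assoc x a _ ⟨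
      (x + a) + a * pred N    ≡⟨ cong (_+ a * pred N) (+-comm x a) ⟩
      (a + x) + a * pred N    ∎

  %-injective-< : ∀ {a b} → a < N → b < N → a % N ≡ b % N → a ≡ b
  %-injective-< a<N b<N eq = trans (sym (m<n⇒m%n≡m a<N)) (trans eq (m<n⇒m%n≡m b<N))

  %ℕ-neg-inverse : ∀ b → (-[1+ b ] %ℕ N + suc b) % N ≡ 0
  %ℕ-neg-inverse b with suc b % N in eq
  ... | zero = eq
  ... | suc r = begin
    (N ∸ suc r + suc b) % N         ≡⟨ %-absorbʳ (N ∸ suc r) (suc b) ⟨
    (N ∸ suc r + suc b % N) % N     ≡⟨ cong (λ z → (N ∸ suc r + z) % N) eq ⟩
    (N ∸ suc r + suc r) % N         ≡⟨ %-congˡ (m∸n+n≡m r<N) ⟩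
    N % N                           ≡⟨ n%n≡0 N ⟩
    0                               ∎
    where
    r<N : suc r ≤ N
    r<N = subst (_≤ N) eq (<⇒≤ (m%n<n (suc b) N))

  %ℕ-suc : ∀ i → (i ℤ.+ + 1) %ℕ N ≡ suc (i %ℕ N) % N
  %ℕ-suc (+ a) = trans (%-congˡ (+-comm a 1)) (sym (%-absorbʳ 1 a))
  %ℕ-suc -[1+ zero ] =
    trans (m<n⇒m%n≡m (>-nonZero⁻¹ N)) (sym (trans (%-congˡ (+-comm 1 _)) (%ℕ-neg-inverse 0)))
  %ℕ-suc -[1+ suc b ] = %-injective-< (n%ℕd<d -[1+ b ] N) (m%n<n _ N) (%-cancelˡ-+ (suc b) _ _ (begin
    (suc b + A) % N             ≡⟨ %-congˡ (+-comm (suc b) A) ⟩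
    (A + suc b) % N             ≡⟨ %ℕ-neg-inverse b ⟩
    0                           ≡⟨ %ℕ-neg-inverse (suc b) ⟨
    (B + suc (suc b)) % N       ≡⟨ %-congˡ (trans (+-suc B (suc b)) (cong suc (+-comm B (suc b)))) ⟩
    (suc (suc b + B)) % N       ≡⟨ %-congˡ (+-suc (suc b) B) ⟨
    (suc b + suc B) % N         ≡⟨ %-absorbʳ (suc b) (suc B) ⟨
    (suc b + suc B % N) % N     ∎))
    where
    A B : ℕ
    A = -[1+ b ] %ℕ N
    B = -[1+ suc b ] %ℕ N

  %ℕ-+ : ∀ i k → (i ℤ.+ + k) %ℕ N ≡ (i %ℕ N + k) % N
  %ℕ-+ i zero = begin
    (i ℤ.+ + 0) %ℕ N   ≡⟨ cong (_%ℕ N) (ℤ.+-identityʳ i) ⟩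
    i %ℕ N             ≡⟨ m<n⇒m%n≡m (n%ℕd<d i N) ⟨
    i %ℕ N % N         ≡⟨ %-congˡ (+-identityʳ _) ⟨
    (i %ℕ N + 0) % N   ∎
  %ℕ-+ i (suc k) = begin
    (i ℤ.+ + suc k) %ℕ N           ≡⟨ cong (λ z → (i ℤ.+ + z) %ℕ N) (+-comm 1 k) ⟩
    (i ℤ.+ + (k + 1)) %ℕ N         ≡⟨ cong (_%ℕ N) (ℤ.+-assoc i (+ k) (+ 1)) ⟨
    ((i ℤ.+ + k) ℤ.+ + 1) %ℕ N     ≡⟨ %ℕ-suc (i ℤ.+ + k) ⟩
    suc ((i ℤ.+ + k) %ℕ N) % N     ≡⟨ cong (λ z → suc z % N) (%ℕ-+ i k) ⟩
    suc ((i %ℕ N + k) % N) % N     ≡⟨ %-absorbʳ 1 (i %ℕ N + k) ⟩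
    suc (i %ℕ N + k) % N           ≡⟨ %-congˡ (+-suc (i %ℕ N) k) ⟨
    (i %ℕ N + suc k) % N           ∎

module Vertices (N : ℕ) .{{_ : NonZero N}} where
  open Residues N
  open ≡-Reasoning

  toℕ-v : ∀ i → toℕ (v N i) ≡ i %ℕ N
  toℕ-v i = toℕ-fromℕ< (n%ℕd<d i N)

  v-≡ : ∀ i j → i %ℕ N ≡ j %ℕ N → v N i ≡ v N j
  v-≡ i j eq = toℕ-injective (trans (toℕ-v i) (trans eq (sym (toℕ-v j))))

  v≡⇒%ℕ≡ : ∀ i j → v N i ≡ v N j → i %ℕ N ≡ j %ℕ N
  v≡⇒%ℕ≡ i j eq = trans (sym (toℕ-v i)) (trans (cong toℕ eq) (toℕ-v j))

  v-toℕ : ∀ x → v N (+ toℕ x) ≡ x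
  v-toℕ x = toℕ-injective (trans (toℕ-v (+ toℕ x)) (m<n⇒m%n≡m (toℕ<n x)))

  v-% : ∀ x → v N (+ (x % N)) ≡ v N (+ x)
  v-% x = v-≡ (+ (x % N)) (+ x) (m%n%n≡m%n x N)

  v-periodic : ∀ x → v N (+ (x + N)) ≡ v N (+ x)
  v-periodic x = v-≡ (+ (x + N)) (+ x) ([m+n]%n≡m%n x N)

  v-+ : ∀ i a k → v N i ≡ v N (+ a) → v N (i ℤ.+ + k) ≡ v N (+ (a + k))
  v-+ i a k eq = v-≡ (i ℤ.+ + k) (+ (a + k)) (begin
    (i ℤ.+ + k) %ℕ N      ≡⟨ %ℕ-+ i k ⟩
    (i %ℕ N + k) % N      ≡⟨ cong (λ z → (z + k) % N) (v≡⇒%ℕ≡ i (+ a) eq) ⟩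
    (a % N + k) % N       ≡⟨ %-absorbˡ a k ⟩
    (a + k) % N           ∎)

  v-∸ : ∀ i a k → v N i ≡ v N (+ (a + k)) → v N (i ℤ.- + k) ≡ v N (+ a)
  v-∸ i a k eq = v-≡ (i ℤ.- + k) (+ a) (trans (sym (m<n⇒m%n≡m (n%ℕd<d (i ℤ.- + k) N)))
    (%-cancelˡ-+ k _ a (begin
      (k + r) % N                    ≡⟨ %-congˡ (+-comm k r) ⟩
      (r + k) % N                    ≡⟨ %ℕ-+ (i ℤ.- + k) k ⟨
      ((i ℤ.- + k) ℤ.+ + k) %ℕ N     ≡⟨ cong (_%ℕ N) i-k+k≡i ⟩
      i %ℕ N                         ≡⟨ v≡⇒%ℕ≡ i (+ (a + k)) eq ⟩
      (a + k) % N                    ≡⟨ %-congˡ (+-comm a k) ⟩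
      (k + a) % N                    ∎)))
    where
    r : ℕ
    r = (i ℤ.- + k) %ℕ N
    i-k+k≡i : (i ℤ.- + k) ℤ.+ + k ≡ i
    i-k+k≡i = trans (ℤ.+-assoc i (ℤ.- + k) (+ k))
      (trans (cong (λ z → i ℤ.+ z) (ℤ.+-inverseˡ (+ k))) (ℤ.+-identityʳ i))

  offset : ℕ → Fin N → ℕ
  offset s x = (toℕ x + (N ∸ s % N)) % N

  offset<N : ∀ s x → offset s x < N
  offset<N s x = m%n<n _ N

  v-offset : ∀ s x → v N (+ (s + offset s x)) ≡ x
  v-offset s x = toℕ-injective (begin
    toℕ (v N (+ (s + offset s x)))     ≡⟨ toℕ-v (+ (s + offset s x)) ⟩
    (s + (t + c) % N) % N              ≡⟨ %-absorbʳ s (t + c) ⟩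
    (s + (t + c)) % N                  ≡⟨ %-absorbˡ s (t + c) ⟨
    (s % N + (t + c)) % N              ≡⟨ %-congˡ (+-comm (s % N) (t + c)) ⟩
    (t + c + s % N) % N                ≡⟨ %-congˡ (+-assoc t c (s % N)) ⟩
    (t + (c + s % N)) % N              ≡⟨ %-congˡ (cong (λ z → t + z) (m∸n+n≡m (<⇒≤ (m%n<n s N)))) ⟩
    (t + N) % N                        ≡⟨ [m+n]%n≡m%n t N ⟩
    t % N                              ≡⟨ m<n⇒m%n≡m (toℕ<n x) ⟩
    t                                  ∎)
    where
    t c : ℕ
    t = toℕ x
    c = N ∸ s % N

  offset-unique : ∀ s {x d} → d < N → v N (+ (s + d)) ≡ x → offset s x ≡ d
  offset-unique s {x} {d} d<N eq = %-injective-< (offset<N s x) d<N (%-cancelˡ-+ s _ _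
    (v≡⇒%ℕ≡ (+ (s + offset s x)) (+ (s + d)) (trans (v-offset s x) (sym eq))))

  agree-from : ∀ s {A B : Fin N → Bool} →
    (∀ d → d < N → A (v N (+ (s + d))) ≡ B (v N (+ (s + d)))) → ∀ x → A x ≡ B x
  agree-from s {A} {B} h x = subst (λ y → A y ≡ B y) (v-offset s x) (h (offset s x) (offset<N s x))

Closed₃ : Bool → Bool → Bool → Set
Closed₃ a b c = b2n a + b2n b + b2n c ≤ 1 ⊎ b2n a + b2n b + b2n c ≡ 3

closed₃-tt : ∀ {c} → Closed₃ true true c → c ≡ true
closed₃-tt {true}  _ = refl
closed₃-tt {false} (inj₁ (s≤s ()))

closed₃-tf : ∀ {c} → Closed₃ true false c → c ≡ false
closed₃-tf {false} _ = refl
closed₃-tf {true}  (inj₁ (s≤s ()))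

closed₃-ft : ∀ {c} → Closed₃ false true c → c ≡ false
closed₃-ft {false} _ = refl
closed₃-ft {true}  (inj₁ (s≤s ()))

module SquareCycle (m : ℕ) (G : Subgraph (suc (suc m))) where
  N : ℕ
  N = suc (suc m)

  open Residues N
  open Vertices N

  e f : ℕ → Bool
  e x = frame G (v N (+ x))
  f x = window G (v N (+ x))

  e-periodic : ∀ x → e (x + N) ≡ e x
  e-periodic x = cong (frame G) (v-periodic x)

  f-periodic : ∀ x → f (x + N) ≡ f x
  f-periodic x = cong (window G) (v-periodic x)

  e-at : ∀ {x y b} → x ≡ y → e x ≡ b → e y ≡ b
  e-at refl h = h

  f-at : ∀ {x y b} → x ≡ y → f x ≡ b → f y ≡ b
  f-at refl h = h

  e-everywhere : ∀ {b} → (∀ x → x < N → e x ≡ b) → ∀ x → e x ≡ b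
  e-everywhere h x = trans (cong (frame G) (sym (v-% x))) (h (x % N) (m%n<n x N))

  f-everywhere : ∀ {b} → (∀ x → x < N → f x ≡ b) → ∀ x → f x ≡ b
  f-everywhere h x = trans (cong (window G) (sym (v-% x))) (h (x % N) (m%n<n x N))

  frame-e : ∀ x → frame G x ≡ e (toℕ x)
  frame-e x = cong (frame G) (sym (v-toℕ x))

  window-f : ∀ x → window G x ≡ f (toℕ x)
  window-f x = cong (window G) (sym (v-toℕ x))

  module _ (closed : Closed G) where
    private
      triangle : ∀ {x a b} → e x ≡ a → e (suc x) ≡ b → Closed₃ a b (f x)
      triangle {x} refl refl = subst (λ y → Closed₃ (e x) (frame G (v N (+ y))) (f x)) (+-comm x 1) (closed (+ x))

    window-between-frames : ∀ {x} → e x ≡ true → e (suc x) ≡ true → f x ≡ true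
    window-between-frames {x} h₀ h₁ = closed₃-tt (triangle {x} h₀ h₁)

    window-after-frame : ∀ {x} → e x ≡ true → e (suc x) ≡ false → f x ≡ false
    window-after-frame {x} h₀ h₁ = closed₃-tf (triangle {x} h₀ h₁)

    window-before-frame : ∀ {x} → e x ≡ false → e (suc x) ≡ true → f x ≡ false
    window-before-frame {x} h₀ h₁ = closed₃-ft (triangle {x} h₀ h₁)

  -- P is a set of offsets from s; the wrap conditions make it well defined on the cycle.
  cut-trivial : WeaklyConnected G → (s : ℕ) {P : ℕ → Set} →
    (∀ d → e (s + d) ≡ true → P d ⇔ P (suc d)) →
    (∀ d → f (s + d) ≡ true → P d ⇔ P (2 + d)) →
    P N ⇔ P 0 → P (suc N) ⇔ P 1 →
    ∀ {d₁ d₂} → d₁ < N → d₂ < N → P d₁ → P d₂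
  cut-trivial connected s {P} frame-closed window-closed wrap₀ wrap₁ {d₁} {d₂} d₁<N d₂<N =
    subst P (offset-unique s d₂<N refl)
    ∘ transport (connected (v N (+ (s + d₁))) (v N (+ (s + d₂))))
    ∘ subst P (sym (offset-unique s d₁<N refl))
    where
    open ≡-Reasoning

    P-mod : ∀ x → x < 2 + N → P x ⇔ P (x % N)
    P-mod x x<2+N with m≤n⇒m<n∨m≡n (≤-pred x<2+N)
    ... | inj₂ refl = subst (λ z → P (suc N) ⇔ P z)
                        (sym (trans ([m+n]%n≡m%n 1 N) (m<n⇒m%n≡m {n = N} (s≤s (s≤s z≤n))))) wrap₁
    ... | inj₁ x≤N with m≤n⇒m<n∨m≡n (≤-pred x≤N)
    ...   | inj₂ refl = subst (λ z → P N ⇔ P z) (sym (n%n≡0 N)) wrap₀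
    ...   | inj₁ x<N  = subst (λ z → P x ⇔ P z) (sym (m<n⇒m%n≡m x<N)) ⇔.refl

    Q : Fin N → Set
    Q x = P (offset s x)

    edge : ∀ i k → k ≤ 2 → P (offset s (v N i)) ⇔ P (k + offset s (v N i)) →
           Q (v N i) ⇔ Q (v N (i ℤ.+ + k))
    edge i k k≤2 P-step = ⇔.trans P-step
      (subst (λ z → P (k + d) ⇔ P z) (sym (offset-unique s (m%n<n (k + d) N) target))
        (P-mod (k + d) (+-mono-≤-< k≤2 (offset<N s (v N i)))))
      where
      d : ℕ
      d = offset s (v N i)
      target : v N (+ (s + (k + d) % N)) ≡ v N (i ℤ.+ + k)
      target = begin
        v N (+ (s + (k + d) % N))   ≡⟨ v-≡ (+ (s + (k + d) % N)) (+ (s + (k + d))) (%-absorbʳ s (k + d)) ⟩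
        v N (+ (s + (k + d)))       ≡⟨ cong (λ z → v N (+ (s + z))) (+-comm k d) ⟩
        v N (+ (s + (d + k)))       ≡⟨ cong (λ z → v N (+ z)) (+-assoc s d k) ⟨
        v N (+ (s + d + k))         ≡⟨ v-+ i (s + d) k (sym (v-offset s (v N i))) ⟨
        v N (i ℤ.+ + k)             ∎

    frame-at : ∀ {x} → T (frame G x) → e (s + offset s x) ≡ true
    frame-at {x} h = to T-≡ (subst (T ∘ frame G) (sym (v-offset s x)) h)

    window-at : ∀ {x} → T (window G x) → f (s + offset s x) ≡ true
    window-at {x} h = to T-≡ (subst (T ∘ window G) (sym (v-offset s x)) h)

    along : ∀ {x y} → Adj G x y → Q x → Q y
    along (fwdE i h) = to   (edge i 1 (s≤s z≤n) (frame-closed _ (frame-at h)))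
    along (bwdE i h) = from (edge i 1 (s≤s z≤n) (frame-closed _ (frame-at h)))
    along (fwdF i h) = to   (edge i 2 ≤-refl (window-closed _ (window-at h)))
    along (bwdF i h) = from (edge i 2 ≤-refl (window-closed _ (window-at h)))

    transport : ∀ {x y} → Reach G x y → Q x → Q y
    transport here       q = q
    transport (step a r) q = transport r (along a q)

  record Gap (p L : ℕ) : Set where
    field
      before : e p ≡ true
      inside : ∀ t → t < L → e (p + suc t) ≡ false
      after  : e (p + suc L) ≡ true

  gap-from : ∀ {q} n → e q ≡ true → e (q + suc n) ≡ true → ∃[ L ] L ≤ n × Gap q L
  gap-from {q} n eq eqn with least-true (λ t → e (q + suc t)) n eqn
  ... | L , L≤n , after , inside = L , L≤n , record { before = eq ; inside = inside ; after = after }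

  gap-length : ∀ {p L} → Gap p L → L < N
  gap-length {p} g = ≰⇒> λ N≤L → clash (trans (e-periodic p) (Gap.before g)) (Gap.inside g (suc m) N≤L)

  module _ (closed : Closed G) {p l : ℕ} (g : Gap p (suc l)) where
    open Gap g

    gap-window-before : f p ≡ false
    gap-window-before = window-after-frame closed {p} before (e-at (+-comm p 1) (inside 0 z<s))

    gap-window-after : f (p + suc l) ≡ false
    gap-window-after = window-before-frame closed {p + suc l} (inside l ≤-refl) (e-at (+-suc p (suc l)) after)

  frames-absent-closed : ∀ s {P : ℕ → Set} →
    (∀ {d} → P d → e (s + d) ≡ false) → (∀ {d} → P (suc d) → e (s + d) ≡ false) →
    ∀ d → e (s + d) ≡ true → P d ⇔ P (suc d)
  frames-absent-closed s at before d present =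
    mk⇔ (⊥-elim ∘ clash present ∘ at) (⊥-elim ∘ clash present ∘ before)

  -- The frame/window pattern of S_{n,k,p+2}, read from position p.
  record SPattern (p k : ℕ) : Set where
    field
      fits           : suc (2 * k) ≤ N
      frame-absent   : ∀ t → t < suc (2 * k) → e (p + suc t) ≡ false
      frame-present  : ∀ t → suc (2 * k) ≤ t → t < N → e (p + suc t) ≡ true
      window-absent₀ : f p ≡ false
      window-absent₁ : f (p + suc (2 * k)) ≡ false
      window-present : ∀ d → 0 < d → d < N → d ≢ suc (2 * k) → f (p + d) ≡ true

  module SPattern⇒S {p k : ℕ} (pat : SPattern p k) where
    open SPattern pat
    j L : ℕ
    j = (p + 2) % N
    L = suc (2 * k)

    H : Subgraph N
    H = S N k (+ j)

    removed : ℕ → Fin N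
    removed t = v N (+ j ℤ.- + 1 ℤ.+ + t)

    removed≡ : ∀ t → removed t ≡ v N (+ (suc p + t))
    removed≡ t = v-+ (+ j ℤ.- + 1) (suc p) t
      (v-∸ (+ j) (suc p) 1 (trans (v-% (p + 2)) (cong (λ x → v N (+ x)) (+-suc p 1))))

    frames : ∀ t → t < N → frame G (v N (+ (suc p + t))) ≡ frame H (v N (+ (suc p + t)))
    frames t t<N with t <? L
    ... | yes t<L = trans (trans (cong e (sym (+-suc p t))) (frame-absent t t<L))
                      (sym (cong not (to T-≡ (from (any-≟-upTo removed L _) (t , t<L , removed≡ t)))))
    ... | no t≮L = trans (trans (cong e (sym (+-suc p t))) (frame-present t (≮⇒≥ t≮L) t<N))
                      (sym (cong not (¬-not (t≮L ∘ not-removed ∘ from T-≡))))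
      where
      not-removed : T (any (λ y → ⌊ y ≟ v N (+ (suc p + t)) ⌋) (map removed (upTo L))) → t < L
      not-removed h with to (any-≟-upTo removed L _) h
      ... | t′ , t′<L , eq = subst (_< L) (trans (sym (offset-unique (suc p) (<-≤-trans t′<L fits)
                                (trans (sym (removed≡ t′)) eq))) (offset-unique (suc p) t<N refl)) t′<L

    W₁ W₂ : Fin N
    W₁ = v N (+ j ℤ.- + 2)
    W₂ = v N (+ j ℤ.+ + (2 * k) ℤ.- + 1)

    W₁≡ : W₁ ≡ v N (+ (p + 0))
    W₁≡ = trans (v-∸ (+ j) p 2 (v-% (p + 2))) (cong (λ x → v N (+ x)) (sym (+-identityʳ p)))

    W₂≡ : W₂ ≡ v N (+ (p + L))
    W₂≡ = v-∸ (+ j ℤ.+ + (2 * k)) (p + L) 1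
      (trans (v-+ (+ j) (p + 2) (2 * k) (v-% (p + 2))) (cong (λ x → v N (+ x)) (shift p k)))
      where
      shift : ∀ p k → p + 2 + 2 * k ≡ p + suc (2 * k) + 1
      shift = solve-∀

    -- When 2k + 1 = N the two removed windows coincide.
    far-window : ∀ {d} → d < N → W₂ ≡ v N (+ (p + d)) → d ≡ 0 ⊎ d ≡ L
    far-window {d} d<N eq with m≤n⇒m<n∨m≡n fits
    ... | inj₁ L<N  = inj₂ (trans (sym (offset-unique p d<N refl)) (offset-unique p L<N (trans (sym W₂≡) eq)))
    ... | inj₂ L≡N = inj₁ (trans (sym (offset-unique p d<N refl)) (offset-unique p z<s
                      (trans (trans (cong (λ x → v N (+ x)) (+-identityʳ p)) (sym (v-periodic p)))
                        (trans (cong (λ x → v N (+ (p + x))) (sym L≡N)) (trans (sym W₂≡) eq)))))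

    windows : ∀ d → d < N → window G (v N (+ (p + d))) ≡ window H (v N (+ (p + d)))
    windows d d<N with d ℕ.≟ 0 | d ℕ.≟ L
    ... | yes refl | _ = trans (trans (cong f (+-identityʳ p)) window-absent₀)
                          (sym (cong (λ b → not (b ∨ ⌊ W₂ ≟ v N (+ (p + 0)) ⌋)) (⌊⌋-yes (W₁ ≟ _) W₁≡)))
    ... | no _ | yes refl = trans window-absent₁
                          (sym (trans (cong (λ b → not (⌊ W₁ ≟ y ⌋ ∨ b)) (⌊⌋-yes (W₂ ≟ y) W₂≡))
                                      (cong not (∨-zeroʳ ⌊ W₁ ≟ y ⌋))))
      where
      y : Fin N
      y = v N (+ (p + L))
    ... | no d≢0 | no d≢L = trans (window-present d (n≢0⇒n>0 d≢0) d<N d≢L)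
                          (sym (cong₂ (λ a b → not (a ∨ b))
                            (⌊⌋-no (W₁ ≟ _) (λ eq → d≢0 (trans (sym (offset-unique p d<N refl))
                                                          (offset-unique p z<s (trans (sym W₁≡) eq)))))
                            (⌊⌋-no (W₂ ≟ _) (λ eq → [ d≢0 , d≢L ]′ (far-window d<N eq)))))

  pattern-is-S : ∀ {p k} → SPattern p k → G ≐ S N k (+ ((p + 2) % N))
  pattern-is-S {p} {k} pat = agree-from (suc p) frames , agree-from p windows
    where open SPattern⇒S {p} {k} pat

  module Classification (connected : WeaklyConnected G) (closed : Closed G) where

    interior-cut-empty : ∀ s {P : ℕ → Set} →
      (∀ d → e (s + d) ≡ true → P d ⇔ P (suc d)) →
      (∀ d → f (s + d) ≡ true → P d ⇔ P (2 + d)) →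
      (∀ {d} → P d → 2 ≤ d × d < N) → ∀ {d} → P d → ⊥
    interior-cut-empty s {P} frame-closed window-closed interior Pd =
      low z<s (cut-trivial connected s frame-closed window-closed
        (mk⇔ (⊥-elim ∘ beyond ≤-refl) (⊥-elim ∘ low z<s))
        (mk⇔ (⊥-elim ∘ beyond (n≤1+n N)) (⊥-elim ∘ low (s≤s z<s)))
        (proj₂ (interior Pd)) z<s Pd)
      where
      low : ∀ {x} → x < 2 → ¬ P x
      low x<2 Px = <⇒≱ x<2 (proj₁ (interior Px))
      beyond : ∀ {x} → N ≤ x → ¬ P x
      beyond N≤x Px = <⇒≱ (proj₂ (interior Px)) N≤x

    isolated-even-segment : ∀ p j → 2 + 2 * j < N →
      (∀ t → t < 2 + 2 * j → e (p + suc t) ≡ false) →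
      f p ≡ false → f (p + (2 + 2 * j)) ≡ false → ⊥
    isolated-even-segment p j bound absent f₀ f₁ =
      interior-cut-empty p frame-closed window-closed interior (j , ≤-refl , refl)
      where
      interior : ∀ {d} → Run 2 j d → 2 ≤ d × d < N
      interior r = proj₁ (run-bounds 2 r) , ≤-<-trans (proj₂ (run-bounds 2 r)) bound

      frame-closed : ∀ d → e (p + d) ≡ true → Run 2 j d ⇔ Run 2 j (suc d)
      frame-closed = frames-absent-closed p
        (λ { (i , i≤j , refl) → absent (suc (2 * i)) (s≤s (s≤s (*-monoʳ-≤ 2 i≤j))) })
        (λ { (i , i≤j , eq) → subst (λ d → e (p + d) ≡ false) (sym (suc-injective eq))
                                 (absent (2 * i) (s≤s (m≤n⇒m≤1+n (*-monoʳ-≤ 2 i≤j)))) })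

      window-closed : ∀ d → f (p + d) ≡ true → Run 2 j d ⇔ Run 2 j (2 + d)
      window-closed d present = mk⇔ forward backward
        where
        forward : Run 2 j d → Run 2 j (2 + d)
        forward r with run-next 2 r
        ... | inj₂ r′ = r′
        ... | inj₁ eq = ⊥-elim (clash (subst (λ x → f (p + x) ≡ true) eq present) f₁)
        backward : Run 2 j (2 + d) → Run 2 j d
        backward r with run-prev 2 r
        ... | inj₂ r′ = r′
        ... | inj₁ eq = ⊥-elim (clash (f-at p+d≡p present) f₀)
          where
          p+d≡p : p + d ≡ p
          p+d≡p = trans (cong (λ x → p + x) (+-cancelˡ-≡ 2 d 0 eq)) (+-identityʳ p)

    odd-segment-windows : ∀ p k → suc (2 * k) ≤ N →
      (∀ t → t < suc (2 * k) → e (p + suc t) ≡ false) →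
      f p ≡ false → f (p + suc (2 * k)) ≡ false →
      ∀ t → 0 < t → t < suc (2 * k) → f (p + t) ≡ true
    odd-segment-windows p k L≤N absent f₀ f₁ t 0<t t<L with f (p + t) in ft
    ... | true  = refl
    ... | false with even-or-odd t
    ...   | inj₁ (zero , refl) = ⊥-elim (<-irrefl refl 0<t)
    ...   | inj₁ (suc h , refl) = ⊥-elim (isolated-even-segment p h
              (<-≤-trans t<L′ L≤N) (λ i i<t → absent i (<-trans i<t t<L′))
              f₀ (subst (λ x → f (p + x) ≡ false) (*-suc 2 h) ft))
      where
      t<L′ : 2 + 2 * h < suc (2 * k)
      t<L′ = subst (_< suc (2 * k)) (*-suc 2 h) t<L
    ...   | inj₂ (h , refl) with odd-complement {h} {k} (*-cancelˡ-< 2 h k (≤-pred t<L))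
    ...     | r , t+seg≡L = ⊥-elim (isolated-even-segment (p + t) r
              (<-≤-trans (subst (2 + 2 * r <_) t+seg≡L (m<n+m _ 0<t)) L≤N)
              absent′ ft (f-at far-end f₁))
      where
      far-end : p + suc (2 * k) ≡ p + t + (2 + 2 * r)
      far-end = trans (cong (λ x → p + x) (sym t+seg≡L)) (sym (+-assoc p t _))
      absent′ : ∀ i → i < 2 + 2 * r → e (p + t + suc i) ≡ false
      absent′ i i<seg = e-at (trans (cong (λ x → p + x) (sym (+-suc t i))) (sym (+-assoc p t (suc i))))
        (absent (t + i) (subst (t + i <_) t+seg≡L (+-monoʳ-< t i<seg)))

    gap-odd : ∀ {p L} → Gap p L → 0 < L → ∃[ k ] L ≡ suc (2 * k)
    gap-odd {p} {L} g 0<L with even-or-odd L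
    ... | inj₂ odd = odd
    ... | inj₁ (zero , refl) = ⊥-elim (<-irrefl refl 0<L)
    ... | inj₁ (suc j , refl) = ⊥-elim (isolated-even-segment p j (gap-length g′) (Gap.inside g′)
                                  (gap-window-before closed g′) (gap-window-after closed g′))
      where
      g′ : Gap p (2 + 2 * j)
      g′ = subst (Gap p) (*-suc 2 j) g

    odd-gap-windows : ∀ {p k} → Gap p (suc (2 * k)) → ∀ t → 0 < t → t < suc (2 * k) → f (p + t) ≡ true
    odd-gap-windows {p} {k} g = odd-segment-windows p k (<⇒≤ (gap-length g)) (Gap.inside g)
      (gap-window-before closed g) (gap-window-after closed g)

    module TwoOddGaps {p c k k₂ : ℕ} (g₁ : Gap p (suc (2 * k))) (g₂ : Gap (p + c) (suc (2 * k₂)))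
                      (2+2k≤c : 2 + 2 * k ≤ c) (bound : c + suc (2 * k₂) < N) where
      Arc : ℕ → Set
      Arc d = 2 + 2 * k ≤ d × d ≤ suc c

      P : ℕ → Set
      P d = Run 2 k d ⊎ Arc d ⊎ Run (suc c) k₂ d

      top : suc c + 2 * k₂ < N
      top = subst (_< N) (+-suc c (2 * k₂)) bound

      reassoc : ∀ t → p + c + suc t ≡ p + (suc c + t)
      reassoc t = trans (+-assoc p c (suc t)) (cong (λ x → p + x) (+-suc c t))

      absent₁ : ∀ t → t < suc (2 * k) → e (p + suc t) ≡ false
      absent₁ = Gap.inside g₁

      absent₂ : ∀ t → t < suc (2 * k₂) → e (p + (suc c + t)) ≡ false
      absent₂ t t<L = e-at (reassoc t) (Gap.inside g₂ t t<L)

      f₀ : f (p + 0) ≡ false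
      f₀ = f-at (sym (+-identityʳ p)) (gap-window-before closed g₁)

      f₁ : f (p + suc (2 * k)) ≡ false
      f₁ = gap-window-after closed g₁

      f₂ : f (p + c) ≡ false
      f₂ = gap-window-before closed g₂

      f₃ : f (p + (suc c + 2 * k₂)) ≡ false
      f₃ = f-at (reassoc (2 * k₂)) (gap-window-after closed g₂)

      interior : ∀ {d} → P d → 2 ≤ d × d < N
      interior (inj₁ r) = proj₁ (run-bounds 2 r) , ≤-<-trans (proj₂ (run-bounds 2 r)) (≤-<-trans 2+2k≤c c<N)
        where
        c<N : c < N
        c<N = ≤-<-trans (n≤1+n c) (≤-<-trans (m≤m+n (suc c) _) top)
      interior (inj₂ (inj₁ (lo , hi))) = ≤-trans (m≤m+n 2 _) lo , ≤-<-trans hi (≤-<-trans (m≤m+n (suc c) _) top)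
      interior (inj₂ (inj₂ r)) =
        ≤-trans (≤-trans (m≤m+n 2 _) (≤-trans 2+2k≤c (n≤1+n c))) (proj₁ (run-bounds (suc c) r)) ,
        ≤-<-trans (proj₂ (run-bounds (suc c) r)) top

      frame-closed : ∀ d → e (p + d) ≡ true → P d ⇔ P (suc d)
      frame-closed d present = mk⇔ forward backward
        where
        forward : P d → P (suc d)
        forward (inj₁ (i , i≤k , refl)) with m≤n⇒m<n∨m≡n i≤k
        ... | inj₁ i<k  = ⊥-elim (clash present (absent₁ (suc (2 * i)) (s≤s (*-monoʳ-< 2 i<k))))
        ... | inj₂ refl = inj₂ (inj₁ (n≤1+n _ , s≤s 2+2k≤c))
        forward (inj₂ (inj₁ (lo , hi))) with m≤n⇒m<n∨m≡n hi
        ... | inj₁ d<c+1 = inj₂ (inj₁ (m≤n⇒m≤1+n lo , d<c+1))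
        ... | inj₂ d≡c+1 = ⊥-elim (clash-at (λ x → e (p + x)) present
                             (trans d≡c+1 (sym (+-identityʳ (suc c)))) (absent₂ 0 z<s))
        forward (inj₂ (inj₂ (i , i≤k₂ , refl))) =
          ⊥-elim (clash present (absent₂ (2 * i) (s≤s (*-monoʳ-≤ 2 i≤k₂))))

        backward : P (suc d) → P d
        backward (inj₁ (i , i≤k , eq)) = ⊥-elim (clash-at (λ x → e (p + x)) present (suc-injective eq)
                                           (absent₁ (2 * i) (s≤s (*-monoʳ-≤ 2 i≤k))))
        backward (inj₂ (inj₁ (lo , hi))) with m≤n⇒m<n∨m≡n lo
        ... | inj₁ lo<d+1 = inj₂ (inj₁ (≤-pred lo<d+1 , ≤-trans (n≤1+n d) hi))
        ... | inj₂ lo≡d+1 = ⊥-elim (clash-at (λ x → e (p + x)) present (sym (suc-injective lo≡d+1))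
                              (absent₁ (2 * k) ≤-refl))
        backward (inj₂ (inj₂ (zero , _ , eq))) =
          inj₂ (inj₁ (subst Arc (sym (trans (suc-injective eq) (+-identityʳ c))) (2+2k≤c , n≤1+n c)))
        backward (inj₂ (inj₂ (suc i , i<k₂ , eq))) =
          ⊥-elim (clash-at (λ x → e (p + x)) present d≡ (absent₂ (suc (2 * i)) (s≤s (*-monoʳ-< 2 i<k₂))))
          where
          d≡ : d ≡ suc c + suc (2 * i)
          d≡ = trans (suc-injective eq) (trans (+-2*-suc c i) (cong suc (sym (+-suc c (2 * i)))))

      module _ (d : ℕ) (present : f (p + d) ≡ true) where
        private
          clash-f : ∀ {x} → d ≡ x → f (p + x) ≡ false → ⊥
          clash-f = clash-at (λ x → f (p + x)) present

          forward₂ : Run (suc c) k₂ d → P (2 + d)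
          forward₂ r with run-next (suc c) r
          ... | inj₂ r′ = inj₂ (inj₂ r′)
          ... | inj₁ d≡top = ⊥-elim (clash-f d≡top f₃)

          backward₁ : Run 2 k (2 + d) → P d
          backward₁ r with run-prev 2 r
          ... | inj₂ r′ = inj₁ r′
          ... | inj₁ eq = ⊥-elim (clash-f (+-cancelˡ-≡ 2 d 0 eq) f₀)

        window-forward : P d → P (2 + d)
        window-forward (inj₁ r) with run-next 2 r
        ... | inj₂ r′ = inj₁ r′
        ... | inj₁ d≡2+2k with m≤n⇒m<n∨m≡n 2+2k≤c
        ...   | inj₁ 2+2k<c = inj₂ (inj₁ (subst (λ x → 2 + 2 * k ≤ 2 + x) (sym d≡2+2k) (m≤n+m _ 2) ,
                                         subst (λ x → 2 + x ≤ suc c) (sym d≡2+2k) (s≤s 2+2k<c)))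
        ...   | inj₂ 2+2k≡c = ⊥-elim (clash-f (trans d≡2+2k 2+2k≡c) f₂)
        window-forward (inj₂ (inj₁ (lo , hi))) with m≤n⇒m<n∨m≡n hi
        ... | inj₂ d≡c+1 = forward₂ (0 , z≤n , trans d≡c+1 (sym (+-identityʳ (suc c))))
        ... | inj₁ d<c+1 with m≤n⇒m<n∨m≡n (≤-pred d<c+1)
        ...   | inj₁ d<c = inj₂ (inj₁ (≤-trans lo (m≤n+m d 2) , s≤s d<c))
        ...   | inj₂ d≡c = ⊥-elim (clash-f d≡c f₂)
        window-forward (inj₂ (inj₂ r)) = forward₂ r

        window-backward : P (2 + d) → P d
        window-backward (inj₁ r) = backward₁ r
        window-backward (inj₂ (inj₁ (lo , hi))) with m≤n⇒m<n∨m≡n (+-cancelˡ-≤ 2 _ _ lo)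
        ... | inj₂ 2k≡d = backward₁ (k , ≤-refl , cong (λ x → 2 + x) (sym 2k≡d))
        ... | inj₁ 2k<d with m≤n⇒m<n∨m≡n 2k<d
        ...   | inj₂ 2k+1≡d = ⊥-elim (clash-f (sym 2k+1≡d) f₁)
        ...   | inj₁ 2k+1<d = inj₂ (inj₁ (2k+1<d , ≤-trans (m≤n+m d 2) hi))
        window-backward (inj₂ (inj₂ r)) with run-prev (suc c) r
        ... | inj₂ r′ = inj₂ (inj₂ r′)
        ... | inj₁ eq with m≤n⇒m<n∨m≡n 2+2k≤c
        ...   | inj₁ 2+2k<c = inj₂ (inj₁ (≤-pred (subst (2 + 2 * k <_) (sym (suc-injective eq)) 2+2k<c) ,
                                         ≤-trans (m≤n+m d 2) (≤-reflexive eq)))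
        ...   | inj₂ 2+2k≡c = ⊥-elim (clash-f (suc-injective (trans (suc-injective eq) (sym 2+2k≡c))) f₁)

      window-closed : ∀ d → f (p + d) ≡ true → P d ⇔ P (2 + d)
      window-closed d present = mk⇔ (window-forward d present) (window-backward d present)

    two-odd-gaps : ∀ {p c k k₂} → Gap p (suc (2 * k)) → Gap (p + c) (suc (2 * k₂)) →
      2 + 2 * k ≤ c → c + suc (2 * k₂) < N → ⊥
    two-odd-gaps {p} {c} {k} {k₂} g₁ g₂ 2+2k≤c bound =
      interior-cut-empty p frame-closed window-closed interior (inj₂ (inj₁ (≤-refl , m≤n⇒m≤1+n 2+2k≤c)))
      where open TwoOddGaps {p} {c} {k} {k₂} g₁ g₂ 2+2k≤c bound

    odd-gap-from : ∀ {q} n → e q ≡ true → e (q + 1) ≡ false → e (q + suc n) ≡ true →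
      ∃[ k ] suc (2 * k) ≤ n × Gap q (suc (2 * k))
    odd-gap-from n present absent present′ with gap-from n present present′
    ... | zero  , _   , g = ⊥-elim (clash (Gap.after g) absent)
    ... | suc l , L≤n , g with gap-odd g z<s
    ...   | k , refl = k , L≤n , g

    no-second-gap : ∀ {p k} → Gap p (suc (2 * k)) → ∀ u → 2 + 2 * k + u < N →
      e (p + (2 + 2 * k + u)) ≡ true → e (p + suc (2 + 2 * k + u)) ≡ false → ⊥
    no-second-gap {p} {k} g₁ u c<N present absent =
      conclude (odd-gap-from {p + c} n present (e-at (sym c+1) absent) wraps)
      where
      c n : ℕ
      c = 2 + 2 * k + u
      n = N ∸ suc c
      c+n+1≡N : suc (c + n) ≡ N
      c+n+1≡N = m+[n∸m]≡n c<N
      c+1 : p + c + 1 ≡ p + suc c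
      c+1 = trans (+-assoc p c 1) (cong (λ x → p + x) (+-comm c 1))
      wraps : e (p + c + suc n) ≡ true
      wraps = e-at
        (sym (trans (+-assoc p c (suc n)) (cong (λ x → p + x) (trans (+-suc c n) c+n+1≡N))))
        (trans (e-periodic p) (Gap.before g₁))
      conclude : ∃[ k₂ ] suc (2 * k₂) ≤ n × Gap (p + c) (suc (2 * k₂)) → ⊥
      conclude (k₂ , fits , g₂) = two-odd-gaps {p} {c} {k} {k₂} g₁ g₂ (m≤m+n _ u)
        (≤-<-trans (+-monoʳ-≤ c fits) (subst (c + n <_) c+n+1≡N ≤-refl))

    frames-after-odd-gap : ∀ {p k} → Gap p (suc (2 * k)) →
      ∀ t → suc (2 * k) ≤ t → t < N → e (p + suc t) ≡ true
    frames-after-odd-gap {p} {k} g₁ t L≤t t<N with e (p + suc t) in absent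
    ... | true  = refl
    ... | false with m≤n⇒∃[o]m+o≡n L≤t
    ...   | r , refl with transition (λ u → e (p + (2 + 2 * k + u))) r start absent
      where
      start : e (p + (2 + 2 * k + 0)) ≡ true
      start = subst (λ x → e (p + x) ≡ true) (sym (+-identityʳ _)) (Gap.after g₁)
    ...     | u , u<r , present , absent-next = ⊥-elim (no-second-gap {k = k} g₁ u
                (≤-<-trans (≤-pred (+-monoʳ-< (2 + 2 * k) u<r)) t<N) present
                (subst (λ x → e (p + x) ≡ false) (+-suc (2 + 2 * k) u) absent-next))

    odd-gap-pattern : ∀ {p k} → Gap p (suc (2 * k)) → SPattern p k
    odd-gap-pattern {p} {k} g = record
      { fits           = <⇒≤ (gap-length g)
      ; frame-absent   = Gap.inside g
      ; frame-present  = frames-after-odd-gap {k = k} g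
      ; window-absent₀ = gap-window-before closed g
      ; window-absent₁ = gap-window-after closed g
      ; window-present = window-present
      }
      where
      window-present : ∀ d → 0 < d → d < N → d ≢ suc (2 * k) → f (p + d) ≡ true
      window-present d 0<d d<N d≢L with <-cmp d (suc (2 * k))
      ... | tri< d<L _ _ = odd-gap-windows {k = k} g d 0<d d<L
      ... | tri≈ _ d≡L _ = contradiction d≡L d≢L
      ... | tri> _ _ (s≤s L≤t) = window-between-frames closed {p + d}
              (frames-after-odd-gap {k = k} g _ L≤t (<-trans (n<1+n _) d<N))
              (e-at (+-suc p d) (frames-after-odd-gap {k = k} g d (<⇒≤ (s≤s L≤t)) d<N))

    mixed-frames : ∀ {x₀ x₁} → x₁ < N → e x₀ ≡ false → e x₁ ≡ true → ∃[ p ] ∃[ k ] SPattern p k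
    mixed-frames {x₀} {x₁} x₁<N absent present = from-edge (transition (λ u → e (x₁ + u)) (x₀ + (N ∸ x₁))
      (e-at (sym (+-identityʳ x₁)) present) absent′)
      where
      absent′ : e (x₁ + (x₀ + (N ∸ x₁))) ≡ false
      absent′ = e-at (sym (trans (swap x₁ x₀ _) (cong (λ x → x₀ + x) (m+[n∸m]≡n (<⇒≤ x₁<N)))))
        (trans (e-periodic x₀) absent)
        where
        swap : ∀ a b c → a + (b + c) ≡ b + (a + c)
        swap = solve-∀
      from-edge : ∃[ u ] u < x₀ + (N ∸ x₁) × e (x₁ + u) ≡ true × e (x₁ + suc u) ≡ false →
                  ∃[ p ] ∃[ k ] SPattern p k
      from-edge (u , _ , present-u , absent-u) with odd-gap-from {x₁ + u} (suc m) present-u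
        (e-at (sym (trans (+-assoc x₁ u 1) (cong (λ x → x₁ + x) (+-comm u 1)))) absent-u)
        (trans (e-periodic (x₁ + u)) present-u)
      ... | k , _ , g = x₁ + u , k , odd-gap-pattern {k = k} g

    -- Without frames, the windows never change the parity of an offset.
    no-frames-even : (∀ x → e x ≡ false) → ∀ h → N ≡ 2 * h → ⊥
    no-frames-even no-frame h N≡2h =
      1+n≢0 (sym (proj₂ (cut-trivial connected 0 {Odd′} frame-closed window-closed
      (mk⇔ (λ { (i , eq) → ⊥-elim (even≢odd h i (trans (sym N≡2h) eq)) }) (λ { (_ , ()) }))
      (mk⇔ (λ _ → 0 , refl) (λ _ → h , cong suc N≡2h))
      (s≤s (s≤s z≤n)) z<s (0 , refl))))
      where
      Odd′ : ℕ → Set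
      Odd′ d = ∃[ i ] d ≡ suc (2 * i)

      frame-closed : ∀ d → e (0 + d) ≡ true → Odd′ d ⇔ Odd′ (suc d)
      frame-closed = frames-absent-closed 0 (λ {d} _ → no-frame d) (λ {d} _ → no-frame d)

      window-closed : ∀ d → f (0 + d) ≡ true → Odd′ d ⇔ Odd′ (2 + d)
      window-closed d _ = mk⇔
        (λ { (i , eq) → suc i , trans (cong (λ x → 2 + x) eq) (cong suc (sym (*-suc 2 i))) })
        (λ { (zero , ())
           ; (suc i , eq) → i , suc-injective (suc-injective (trans eq (cong suc (*-suc 2 i)))) })

    no-frames : (∀ x → e x ≡ false) → (Odd N × G ≐ WindowsOnly N) ⊎ ∃[ p ] ∃[ k ] SPattern p k
    no-frames no-frame with even-or-odd N
    ... | inj₁ (h , N≡2h) = ⊥-elim (no-frames-even no-frame h N≡2h)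
    ... | inj₂ (k , N≡L) with anyUpTo? (λ x → f x ≟ᵇ false) N
    ...   | no ∄ = inj₁ (odd , (λ x → trans (frame-e x) (no-frame (toℕ x))) ,
                               (λ x → trans (window-f x) (f-everywhere (none-below ∄) (toℕ x))))
      where
      odd : Odd N
      odd = trans (cong (_% 2) (trans N≡L (cong suc (*-comm 2 k)))) ([m+kn]%n≡m%n 1 k 2)
    ...   | yes (p , _ , window-absent) = inj₂ (p , k , record
      { fits           = ≤-reflexive (sym N≡L)
      ; frame-absent   = λ t _ → no-frame (p + suc t)
      ; frame-present  = λ t L≤t t<N → ⊥-elim (<⇒≱ t<N (subst (_≤ t) (sym N≡L) L≤t))
      ; window-absent₀ = window-absent
      ; window-absent₁ = window-absent₁
      ; window-present = λ d 0<d d<N _ → odd-segment-windows p k (≤-reflexive (sym N≡L))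
          (λ t _ → no-frame (p + suc t)) window-absent window-absent₁ d 0<d (subst (d <_) N≡L d<N)
      })
      where
      window-absent₁ : f (p + suc (2 * k)) ≡ false
      window-absent₁ = subst (λ x → f (p + x) ≡ false) N≡L (trans (f-periodic p) window-absent)

    classification : G ≐ Full N ⊎ (Odd N × G ≐ WindowsOnly N) ⊎ ∃[ p ] ∃[ k ] SPattern p k
    classification with anyUpTo? (λ x → e x ≟ᵇ false) N
    ... | no ∄ = inj₁ ((λ x → trans (frame-e x) (all-frames (toℕ x))) ,
                       (λ x → trans (window-f x) (all-windows (toℕ x))))
      where
      all-frames : ∀ x → e x ≡ true
      all-frames = e-everywhere (none-below ∄)
      all-windows : ∀ x → f x ≡ true
      all-windows x = window-between-frames closed {x} (all-frames x) (all-frames (suc x))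
    ... | yes (x₀ , _ , absent) with anyUpTo? (λ x → e x ≟ᵇ true) N
    ...   | yes (x₁ , x₁<N , present) = inj₂ (inj₂ (mixed-frames {x₀} {x₁} x₁<N absent present))
    ...   | no ∄ = inj₂ (no-frames (e-everywhere (none-below ∄)))

theorem3p4 : (n : ℕ) .{{_ : NonZero n}} → 5 ≤ n → (G : Subgraph n) →
    WeaklyConnected G → Closed G → Nontrivial G →
    Σ ℕ (λ j → Σ ℕ (λ k → j < n × k ≤ ceilHalfNm2 n × G ≐ S n k (+ j)))
-- Of 5 ≤ n the argument only uses n ≥ 2.
theorem3p4 (suc (suc m)) (s≤s (s≤s _)) G connected closed (not-full , not-windows-only) =
  conclude (Classification.classification connected closed)
  where
  open SquareCycle m G
  conclude : G ≐ Full N ⊎ (Odd N × G ≐ WindowsOnly N) ⊎ (∃[ p ] ∃[ k ] SPattern p k) →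
             ∃[ j ] ∃[ k ] j < N × k ≤ ceilHalfNm2 N × G ≐ S N k (+ j)
  conclude (inj₁ full)                  = ⊥-elim (not-full full)
  conclude (inj₂ (inj₁ windows-only))   = ⊥-elim (not-windows-only windows-only)
  conclude (inj₂ (inj₂ (p , k , pat))) =
    (p + 2) % N , k , m%n<n (p + 2) N , 2*≤⇒≤/2 (≤-pred (SPattern.fits pat)) , pattern-is-S pat
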